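{- Let $G$ be a finite simple undirected graph, $n\ge1$, and $\sigma: Q_n\to G$ a singular $n$-cube. Then (i) $\partial_n\psi(\sigma)\in\widetilde{\mathcal{C}}_{n-1}(G)$, i.e. it is a linear combination of allowed paths; in particular $\psi(\sigma)\in\mathcal{C}^{\mathrm{Path}}_n(G)$; and (ii) $\partial^{\mathrm{Path}}_n\psi(\sigma)=\psi(\partial^{\mathrm{Cube}}_n\sigma)$.
   Context: $R$ is a commutative ring with unit. A graph homomorphism is a vertex map sending adjacent vertices to equal or adjacent vertices. $Q_n$ is the graph on $\{0,1\}^n$ with edges between vertices at Hamming distance one; a singular $n$-cube on $G$ is a graph homomorphism $Q_n\to G$. For $n\ge1$, $i\in[n]$: $f_i^{\pm}\sigma(a_1,\dots,a_{n-1})=\sigma(a_1,\dots,a_{i-1},\epsilon,a_i,\dots,a_{n-1})$ with $\epsilon=1$ for $+$, $0$ for $-$. The cubical boundary is $\partial^{\mathrm{Cube}}_n\sigma=\sum_{i=1}^n(-1)^i(f_i^-\sigma-f_i^+\sigma)$ (an $R$-linear combination of singular $(n-1)$-cubes). Path complex: for $V=V(G)$, $\mathcal{C}_n(V)$ is the free $R$-module on $(n+1)$-tuples of vertices modulo the span of tuples with $v_i=v_{i+1}$ for some $i$ (such tuples are $0$); $\partial^{\mathrm{Path}}_n(v_0,\dots,v_n)=\sum_{i=0}^n(-1)^i(v_0,\dots,\widehat{v_i},\dots,v_n)$. An allowed path is a tuple with $\{v_i,v_{i+1}\}\in E(G)$ for all $i$; $\widetilde{\mathcal{C}}_n(G)\subseteq\mathcal{C}_n(V)$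 is generated by allowed paths; $\mathcal{C}^{\mathrm{Path}}_n(G)=\{x\in\widetilde{\mathcal{C}}_n(G):\partial_nx\in\widetilde{\mathcal{C}}_{n-1}(G)\}$. The map $\psi$: for a permutation $\tau\in S_n$, let $p_\tau$ be the path $p_\tau(0),p_\tau(1),\dots,p_\tau(n)$ in $Q_n$ starting at $(0,\dots,0)$ whose $i$-th step flips coordinate $\tau(i)$ from $0$ to $1$ (so $p_\tau(n)=(1,\dots,1)$). For a singular $n$-cube $\sigma$, $\sigma\circ p_\tau$ denotes the tuple $(\sigma(p_\tau(0)),\dots,\sigma(p_\tau(n)))\in\mathcal{C}_n(V)$ (which is $0$ if two consecutive entries coincide), and $\psi(\sigma)=\sum_{\tau\in S_n}\mathrm{sign}(\tau)\,\sigma\circ p_\tau$; $\psi$ is extended $R$-linearly. For $n=0$, $\psi$ sends a $0$-cube to the one-vertex tuple of its value. -}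

module Defs where

open import Level using (Level)
open import Algebra.Bundles using (CommutativeRing)
open import Data.Nat using (ℕ; zero; suc; _<_; _>_; _<ᵇ_)
open import Data.Bool using (Bool; true; false; not; if_then_else_)
open import Data.Fin using (Fin; zero; suc; inject₁; punchIn; toℕ)
open import Data.Fin.Properties using () renaming (_≟_ to _≟ᶠ_)
open import Data.Vec using (Vec; []; _∷_; lookup; insertAt; removeAt; _[_]%=_; _[_]≔_; replicate)
import Data.Vec as Vec
open import Data.Vec.Properties using (≡-dec)
open import Data.List using (List; []; _∷_; concatMap; map; _++_; foldr)
open import Data.List.Base using (allFin)
open import Data.Product using (Σ; ∃; _×_; _,_; proj₁; proj₂)
open import Data.Sum using (_⊎_)
open import Relation.Nullary using (¬_; yes; no)
open import Relation.Binary.PropositionalEquality using (_≡_)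

record Graph : Set₁ where
  field
    size   : ℕ
    Adj    : Fin size → Fin size → Set
    sym    : ∀ {u v} → Adj u v → Adj v u
    irrefl : ∀ {u} → ¬ Adj u u

open Graph public

Cube : ℕ → Set
Cube n = Vec Bool n

-- flip the i-th coordinate (the Q_n-neighbours of x are exactly flip x i)
flip : ∀ {n} → Cube n → Fin n → Cube n
flip x i = x [ i ]%= not

record SingularCube (G : Graph) (n : ℕ) : Set where
  field
    fun : Cube n → Fin (size G)
    hom : ∀ (x : Cube n) (i : Fin n) →
          fun x ≡ fun (flip x i) ⊎ Adj G (fun x) (fun (flip x i))

open SingularCube public

-- Permutations of Fin n, as the list of values (τ(1),…,τ(n)),
-- and their sign (via parity of the number of inversions).

perms : (n : ℕ) → List (Vec (Fin n) n)
perms zero    = [] ∷ []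
perms (suc n) = concatMap (λ i → map (λ p → i ∷ Vec.map (punchIn i) p) (perms n)) (allFin (suc n))

inversions : ∀ {n m} → Vec (Fin n) m → ℕ
inversions []       = 0
inversions (x ∷ xs) = Data.Nat._+_ (countLess xs) (inversions xs)
  where
  countLess : ∀ {k} → Vec (Fin _) k → ℕ
  countLess []       = 0
  countLess (y ∷ ys) = if toℕ y <ᵇ toℕ x then suc (countLess ys) else countLess ys

cubePath : ∀ {n m} → Vec (Fin n) m → Cube n → Vec (Cube n) (suc m)
cubePath []       x = x ∷ []
cubePath (c ∷ cs) x = x ∷ cubePath cs (x [ c ]≔ true)

pτ : ∀ {n} → Vec (Fin n) n → Vec (Cube n) (suc n)
pτ τ = cubePath τ (replicate _ false)

module Chains {c ℓ : Level} (R : CommutativeRing c ℓ) (G : Graph) where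
  open CommutativeRing R renaming (Carrier to A)

  sgn : ℕ → A
  sgn zero    = 1#
  sgn (suc k) = - sgn k

  -- tuples of (m) vertices; C_n(V) uses tuples of length n+1
  Tuple : ℕ → Set
  Tuple m = Vec (Fin (size G)) m

  -- formal R-linear combinations of tuples (elements of the free module)
  Chain : ℕ → Set c
  Chain m = List (A × Tuple m)

  scale : ∀ {m} → A → Chain m → Chain m
  scale r = map (λ (s , t) → (r * s , t))

  coeff : ∀ {m} → Chain m → Tuple m → A
  coeff []             t = 0#
  coeff ((r , u) ∷ xs) t with ≡-dec _≟ᶠ_ u t
  ... | yes _ = r + coeff xs t
  ... | no  _ = coeff xs t

  Degenerate : ∀ {m} → Tuple (suc m) → Set
  Degenerate {m} t = ∃ λ (i : Fin m) → lookup t (inject₁ i) ≡ lookup t (suc i)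

  -- equality in C(V) = free module on tuples modulo degenerate tuples:
  -- equal coefficients on every non-degenerate tuple
  _≈ᶜ_ : ∀ {m} → Chain (suc m) → Chain (suc m) → Set ℓ
  _≈ᶜ_ {m} x y = ∀ (t : Tuple (suc m)) → ¬ Degenerate t → coeff x t ≈ coeff y t

  Allowed : ∀ {m} → Tuple (suc m) → Set
  Allowed {m} t = ∀ (i : Fin m) → Adj G (lookup t (inject₁ i)) (lookup t (suc i))

  InTilde : ∀ {m} → Chain (suc m) → Set (Level._⊔_ c ℓ)
  InTilde {m} x = ∃ λ (ys : List (A × Σ (Tuple (suc m)) Allowed)) →
                     x ≈ᶜ map (λ (r , (t , _)) → (r , t)) ys

  ∂Path : ∀ {m} → Chain (suc (suc m)) → Chain (suc m)
  ∂Path = concatMap (λ (r , t) → map (λ i → (r * sgn (toℕ i) , removeAt t i)) (allFin _))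

  InPathComplex : ∀ {m} → Chain (suc (suc m)) → Set (Level._⊔_ c ℓ)
  InPathComplex x = InTilde x × InTilde (∂Path x)

  ψmap : ∀ {n} → (Cube n → Fin (size G)) → Chain (suc n)
  ψmap σ = map (λ τ → (sgn (inversions τ) , Vec.map σ (pτ τ))) (perms _)

  ψ : ∀ {n} → SingularCube G n → Chain (suc n)
  ψ σ = ψmap (fun σ)

  CubeChain : ℕ → Set c
  CubeChain n = List (A × (Cube n → Fin (size G)))

  ψlin : ∀ {n} → CubeChain n → Chain (suc n)
  ψlin = concatMap (λ (r , σ) → scale r (ψmap σ))

  -- faces f_i^± (i 0-indexed here; i = 0 is the paper's i = 1)
  face : ∀ {n} → Bool → Fin (suc n) → (Cube (suc n) → Fin (size G)) → Cube n → Fin (size G)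
  face ε i σ a = σ (insertAt a i ε)

  ∂Cube : ∀ {n} → SingularCube G (suc n) → CubeChain n
  ∂Cube σ = concatMap
    (λ i → (sgn (suc (toℕ i)) , face false i (fun σ))
         ∷ (- sgn (suc (toℕ i)) , face true i (fun σ)) ∷ [])
    (allFin _)

-- Part (ii) is checked against every cochain g, i.e. every R-valued function on
-- vertex tuples: pairing with ∂Path is pairing with the coboundary δ, and pairing
-- with ψ σ is ψ* (g ∘ σ), the signed sum of g along the monotone paths of the
-- cube.  So it suffices to show ψ* (δ h) = Σᵢ (-1)^i (ψ* (h|{xᵢ=1}) - ψ* (h|{xᵢ=0}))
-- for every cochain h on the cube, by induction on the dimension.  Sorting the
-- permutations by their first value splits ψ* into the faces xᵢ = 1 reached by
-- the first step.  Deleting the origin from a path produces those faces; the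
-- remaining deletions give, by induction, a double sum over pairs of faces, in
-- which the terms with two upper faces cancel in pairs and the mixed terms
-- reassemble into the faces xᵢ = 0.  The identity holds on every tuple, degenerate
-- or not.
-- For part (i), ψ of a graph homomorphism is a combination of lazy walks
-- (consecutive vertices equal or adjacent), each allowed or degenerate; as
-- ∂Path (ψ σ) equals ψ of the faces of σ, the same holds for it.

module Submission where

open import Defs hiding (sym)
open import Level using (Level; _⊔_)
open import Algebra.Bundles using (CommutativeRing)
open import Data.Bool using (Bool; true; false; not; if_then_else_)
open import Data.Empty using (⊥-elim)
open import Data.Fin using (Fin; zero; suc; punchIn; toℕ)
open import Data.Fin.Properties using (toℕ≤pred[n]) renaming (_≟_ to _≟ᶠ_)
open import Data.List using (List; []; _∷_; map; concatMap; _++_; allFin; tabulate)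
open import Data.List.Relation.Unary.All as All using (All; []; _∷_)
open import Data.List.Relation.Unary.All.Properties using (concat⁺; map⁺; tabulate⁺; ++⁺)
open import Data.Nat using (ℕ; zero; suc) renaming (_+_ to _+ℕ_)
open import Data.Product using (Σ; _×_; _,_; proj₁; proj₂)
open import Data.Sum using (_⊎_; inj₁; inj₂)
open import Data.Unit using (⊤; tt)
open import Data.Vec using (Vec; []; _∷_; insertAt; removeAt; updateAt; replicate; _[_]≔_)
import Data.Vec as Vec
open import Data.Vec.Properties using (≡-dec; map-∘; map-cong)
open import Function using (_∘_)
open import Relation.Nullary using (yes; no; does)
open import Relation.Binary.PropositionalEquality as ≡ using (_≡_)

module Combinatorics where

  open import Data.Nat using (_+_; _≤_; z≤n; s≤s; _<ᵇ_)
  open import Data.Nat.Properties using (+-cancelʳ-≡; ≤-refl; ≤-trans; ≰⇒>; _≤?_)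
  open ≡ using (refl; cong; cong₂; trans; sym; module ≡-Reasoning)

  countBelow : ∀ {n k} → ℕ → Vec (Fin n) k → ℕ
  countBelow m []       = 0
  countBelow m (y ∷ ys) = if toℕ y <ᵇ m then suc (countBelow m ys) else countBelow m ys

  -- The counting function of inversions is local to its definition; the
  -- induction hypothesis identifies it with countBelow after cancellation.
  inversions-∷ : ∀ {n k} (x : Fin n) (xs : Vec (Fin n) k) →
                 inversions (x ∷ xs) ≡ countBelow (toℕ x) xs + inversions xs
  inversions-∷ x []       = refl
  inversions-∷ x (y ∷ ys) with +-cancelʳ-≡ (inversions ys) _ _ (inversions-∷ x ys) | toℕ y <ᵇ toℕ x
  ... | e | true  = cong (λ z → suc z + inversions (y ∷ ys)) e
  ... | e | false = cong (λ z → z + inversions (y ∷ ys)) e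

  punchIn-<ᵇ : ∀ {n} (i : Fin (suc n)) (y z : Fin n) →
               (toℕ (punchIn i y) <ᵇ toℕ (punchIn i z)) ≡ (toℕ y <ᵇ toℕ z)
  punchIn-<ᵇ zero    y       z       = refl
  punchIn-<ᵇ (suc i) zero    zero    = refl
  punchIn-<ᵇ (suc i) zero    (suc z) = refl
  punchIn-<ᵇ (suc i) (suc y) zero    = refl
  punchIn-<ᵇ (suc i) (suc y) (suc z) = punchIn-<ᵇ i y z

  punchIn-<ᵇ-below : ∀ {n} (i : Fin (suc n)) (y : Fin n) m → m ≤ toℕ i →
                     (toℕ (punchIn i y) <ᵇ m) ≡ (toℕ y <ᵇ m)
  punchIn-<ᵇ-below zero    y       zero    z≤n       = refl
  punchIn-<ᵇ-below (suc i) zero    m       _         = refl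
  punchIn-<ᵇ-below (suc i) (suc y) zero    _         = refl
  punchIn-<ᵇ-below (suc i) (suc y) (suc m) (s≤s m≤i) = punchIn-<ᵇ-below i y m m≤i

  punchIn-<ᵇ-above : ∀ {n} (i : Fin (suc n)) (y : Fin n) m → toℕ i ≤ m →
                     (toℕ (punchIn i y) <ᵇ suc m) ≡ (toℕ y <ᵇ m)
  punchIn-<ᵇ-above zero    y       m       _         = refl
  punchIn-<ᵇ-above (suc i) zero    (suc m) _         = refl
  punchIn-<ᵇ-above (suc i) (suc y) (suc m) (s≤s i≤m) = punchIn-<ᵇ-above i y m i≤m

  countBelow-punchIn : ∀ {n k} (i : Fin (suc n)) (y : Fin n) (ys : Vec (Fin n) k) →
                       countBelow (toℕ (punchIn i y)) (Vec.map (punchIn i) ys) ≡ countBelow (toℕ y) ys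
  countBelow-punchIn i y []       = refl
  countBelow-punchIn i y (z ∷ zs) rewrite punchIn-<ᵇ i z y | countBelow-punchIn i y zs = refl

  countBelow-punchIn-below : ∀ {n k} (i : Fin (suc n)) (ys : Vec (Fin n) k) m → m ≤ toℕ i →
                             countBelow m (Vec.map (punchIn i) ys) ≡ countBelow m ys
  countBelow-punchIn-below i []       m m≤i = refl
  countBelow-punchIn-below i (y ∷ ys) m m≤i
    rewrite punchIn-<ᵇ-below i y m m≤i | countBelow-punchIn-below i ys m m≤i = refl

  countBelow-punchIn-above : ∀ {n k} (i : Fin (suc n)) (ys : Vec (Fin n) k) m → toℕ i ≤ m →
                             countBelow (suc m) (Vec.map (punchIn i) ys) ≡ countBelow m ys
  countBelow-punchIn-above i []       m i≤m = refl
  countBelow-punchIn-above i (y ∷ ys) m i≤m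
    rewrite punchIn-<ᵇ-above i y m i≤m | countBelow-punchIn-above i ys m i≤m = refl

  inversions-punchIn : ∀ {n k} (i : Fin (suc n)) (ys : Vec (Fin n) k) →
                       inversions (Vec.map (punchIn i) ys) ≡ inversions ys
  inversions-punchIn i []       = refl
  inversions-punchIn i (y ∷ ys) = begin
    inversions (Vec.map (punchIn i) (y ∷ ys))
      ≡⟨ inversions-∷ (punchIn i y) (Vec.map (punchIn i) ys) ⟩
    countBelow (toℕ (punchIn i y)) (Vec.map (punchIn i) ys) + inversions (Vec.map (punchIn i) ys)
      ≡⟨ cong₂ _+_ (countBelow-punchIn i y ys) (inversions-punchIn i ys) ⟩
    countBelow (toℕ y) ys + inversions ys
      ≡⟨ sym (inversions-∷ y ys) ⟩
    inversions (y ∷ ys) ∎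
    where open ≡-Reasoning

  -- A vector of n elements of Fin n is a permutation iff, for every m ≤ n,
  -- exactly m of its entries are below m.
  IsPermutation : ∀ {n} → Vec (Fin n) n → Set
  IsPermutation {n} p = ∀ m → m ≤ n → countBelow m p ≡ m

  <ᵇ-false : ∀ a m → m ≤ a → (a <ᵇ m) ≡ false
  <ᵇ-false a       zero    _         = refl
  <ᵇ-false (suc a) (suc m) (s≤s m≤a) = <ᵇ-false a m m≤a

  <ᵇ-true : ∀ a m → a ≤ m → (a <ᵇ suc m) ≡ true
  <ᵇ-true zero    m       _         = refl
  <ᵇ-true (suc a) (suc m) (s≤s a≤m) = <ᵇ-true a m a≤m

  isPermutation-∷ : ∀ {n} (i : Fin (suc n)) (p : Vec (Fin n) n) →
                    IsPermutation p → IsPermutation (i ∷ Vec.map (punchIn i) p)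
  isPermutation-∷ i p perm m m≤n with m ≤? toℕ i
  ... | yes m≤i rewrite <ᵇ-false (toℕ i) m m≤i =
    trans (countBelow-punchIn-below i p m m≤i) (perm m (≤-trans m≤i (toℕ≤pred[n] i)))
  ... | no m≰i with m | ≰⇒> m≰i | m≤n
  ... | suc m′ | s≤s i≤m′ | s≤s m′≤n rewrite <ᵇ-true (toℕ i) m′ i≤m′ =
    cong suc (trans (countBelow-punchIn-above i p m′ i≤m′) (perm m′ m′≤n))

  perms-isPermutation : ∀ n → All IsPermutation (perms n)
  perms-isPermutation zero    = (λ { zero z≤n → refl }) ∷ []
  perms-isPermutation (suc n) =
    concat⁺ (map⁺ (tabulate⁺ λ i → map⁺ (All.map (λ {p} → isPermutation-∷ i p) (perms-isPermutation n))))

  inversions-perms-∷ : ∀ {n} (i : Fin (suc n)) (p : Vec (Fin n) n) → IsPermutation p →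
                       inversions (i ∷ Vec.map (punchIn i) p) ≡ toℕ i + inversions p
  inversions-perms-∷ i p perm = trans (inversions-∷ i (Vec.map (punchIn i) p))
    (cong₂ _+_ (trans (countBelow-punchIn-below i p (toℕ i) ≤-refl) (perm (toℕ i) (toℕ≤pred[n] i)))
               (inversions-punchIn i p))

module CubePaths where

  open ≡ using (refl; cong; trans; sym)

  replicate-[]≔ : ∀ {A : Set} {n} (a b : A) (i : Fin (suc n)) →
                  replicate (suc n) a [ i ]≔ b ≡ insertAt (replicate n a) i b
  replicate-[]≔         a b zero    = refl
  replicate-[]≔ {n = suc n} a b (suc i) = cong (a ∷_) (replicate-[]≔ a b i)

  insertAt-replicate : ∀ {A : Set} {n} (a : A) (i : Fin (suc n)) →
                       insertAt (replicate n a) i a ≡ replicate (suc n) a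
  insertAt-replicate         a zero    = refl
  insertAt-replicate {n = suc n} a (suc i) = cong (a ∷_) (insertAt-replicate a i)

  updateAt-insertAt : ∀ {A : Set} {n} (x : Vec A n) (i : Fin (suc n)) (b : A) (c : Fin n) (f : A → A) →
                      updateAt (insertAt x i b) (punchIn i c) f ≡ insertAt (updateAt x c f) i b
  updateAt-insertAt x       zero    b c       f = refl
  updateAt-insertAt (y ∷ x) (suc i) b zero    f = refl
  updateAt-insertAt (y ∷ x) (suc i) b (suc c) f = cong (y ∷_) (updateAt-insertAt x i b c f)

  removeAt-map : ∀ {A B : Set} {n} (f : A → B) (v : Vec A (suc n)) (k : Fin (suc n)) →
                 removeAt (Vec.map f v) k ≡ Vec.map f (removeAt v k)
  removeAt-map f (x ∷ xs)     zero    = refl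
  removeAt-map f (x ∷ y ∷ ys) (suc k) = cong (f x ∷_) (removeAt-map f (y ∷ ys) k)

  cubePath-insertAt : ∀ {n m} (cs : Vec (Fin n) m) (x : Cube n) (i : Fin (suc n)) (b : Bool) →
                      cubePath (Vec.map (punchIn i) cs) (insertAt x i b)
                        ≡ Vec.map (λ y → insertAt y i b) (cubePath cs x)
  cubePath-insertAt []       x i b = refl
  cubePath-insertAt (c ∷ cs) x i b = cong (insertAt x i b ∷_)
    (trans (cong (cubePath (Vec.map (punchIn i) cs)) (updateAt-insertAt x i b c _))
           (cubePath-insertAt cs (x [ c ]≔ true) i b))

  pτ-∷ : ∀ {n} (i : Fin (suc n)) (p : Vec (Fin n) n) →
         pτ (i ∷ Vec.map (punchIn i) p)
           ≡ replicate (suc n) false ∷ Vec.map (λ y → insertAt y i true) (pτ p)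
  pτ-∷ {n} i p = cong (replicate (suc n) false ∷_)
    (trans (cong (cubePath (Vec.map (punchIn i) p)) (replicate-[]≔ false true i))
           (cubePath-insertAt p (replicate n false) i true))

  commuteIndices : ∀ {n} → Fin (suc n) → Fin n → Fin (suc n) × Fin n
  commuteIndices {suc n} zero    j       = suc j , zero
  commuteIndices {suc n} (suc i) zero    = zero , i
  commuteIndices {suc n} (suc i) (suc j) = let (i′ , j′) = commuteIndices i j in suc i′ , suc j′

  insertAt-insertAt : ∀ {A : Set} {m} (y : Vec A m) (i : Fin (suc (suc m))) (j : Fin (suc m)) (a b : A) →
                      let (i′ , j′) = commuteIndices i j in
                      insertAt (insertAt y j b) i a ≡ insertAt (insertAt y j′ a) i′ b
  insertAt-insertAt y       zero    j       a b = refl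
  insertAt-insertAt y       (suc i) zero    a b = refl
  insertAt-insertAt (x ∷ y) (suc i) (suc j) a b = cong (x ∷_) (insertAt-insertAt y i j a b)

  []≔true-or-flip : ∀ {n} (y : Cube n) (c : Fin n) → (y [ c ]≔ true ≡ y) ⊎ (y [ c ]≔ true ≡ flip y c)
  []≔true-or-flip (true  ∷ y) zero    = inj₁ refl
  []≔true-or-flip (false ∷ y) zero    = inj₂ refl
  []≔true-or-flip (b     ∷ y) (suc c) with []≔true-or-flip y c
  ... | inj₁ e = inj₁ (cong (b ∷_) e)
  ... | inj₂ e = inj₂ (cong (b ∷_) e)

module Sums {c ℓ} (R : CommutativeRing c ℓ) where

  open CommutativeRing R renaming (Carrier to A) hiding (zero)
  open import Algebra.Properties.Ring ring using (-‿+-comm; -0#≈0#; x[y-z]≈xy-xz)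
  open import Algebra.Properties.CommutativeSemigroup +-commutativeSemigroup using (interchange; x∙yz≈y∙xz)
  open import Algebra.Properties.Semiring.Sum semiring public
    using (sum; sum-syntax; ∑-distrib-+; *-distribˡ-sum; sum-cong-≋; sum-cong-≗)
  open import Relation.Binary.Reasoning.Setoid setoid
  open CubePaths using (commuteIndices)

  ∑-neg : ∀ {n} (f : Fin n → A) → ∑[ i < n ] (- f i) ≈ - sum f
  ∑-neg {zero}  f = sym -0#≈0#
  ∑-neg {suc n} f = trans (+-congˡ (∑-neg (f ∘ suc))) (-‿+-comm _ _)

  ∑-*-sub : ∀ {n} (w f g : Fin n → A) →
            ∑[ i < n ] (w i * (f i - g i)) ≈ ∑[ i < n ] (w i * f i) - ∑[ i < n ] (w i * g i)
  ∑-*-sub {n} w f g = begin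
    ∑[ i < n ] (w i * (f i - g i))                      ≈⟨ sum-cong-≋ (λ i → x[y-z]≈xy-xz (w i) (f i) (g i)) ⟩
    ∑[ i < n ] (w i * f i + - (w i * g i))              ≈⟨ ∑-distrib-+ (λ i → w i * f i) (λ i → - (w i * g i)) ⟩
    ∑[ i < n ] (w i * f i) + ∑[ i < n ] (- (w i * g i)) ≈⟨ +-congˡ (∑-neg (λ i → w i * g i)) ⟩
    ∑[ i < n ] (w i * f i) - ∑[ i < n ] (w i * g i)     ∎

  ∑∑ : ∀ {n} → (Fin (suc n) → Fin n → A) → A
  ∑∑ {n} f = ∑[ i < suc n ] (∑[ j < n ] f i j)

  ∑∑-neg : ∀ {n} (f : Fin (suc n) → Fin n → A) → ∑∑ (λ i j → - f i j) ≈ - ∑∑ f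
  ∑∑-neg f = trans (sum-cong-≋ (λ i → ∑-neg (f i))) (∑-neg (λ i → sum (f i)))

  _∘commuteIndices : ∀ {n} → (Fin (suc n) → Fin n → A) → Fin (suc n) → Fin n → A
  (f ∘commuteIndices) i j = let (i′ , j′) = commuteIndices i j in f i′ j′

  ∑∑-split : ∀ {n} (f : Fin (suc (suc n)) → Fin (suc n) → A) →
             ∑∑ f ≈ sum (f zero) + (∑[ i < suc n ] (f (suc i) zero) + ∑∑ (λ i j → f (suc i) (suc j)))
  ∑∑-split f = +-congˡ (∑-distrib-+ (λ i → f (suc i) zero) (λ i → ∑[ j < _ ] (f (suc i) (suc j))))

  ∑∑-commuteIndices : ∀ {n} (f : Fin (suc n) → Fin n → A) → ∑∑ f ≈ ∑∑ (f ∘commuteIndices)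
  ∑∑-commuteIndices {zero}  f = refl
  ∑∑-commuteIndices {suc n} f = begin
    ∑∑ f                     ≈⟨ ∑∑-split f ⟩
    X + (Y + ∑∑ f′)          ≈⟨ +-congˡ (+-congˡ (∑∑-commuteIndices f′)) ⟩
    X + (Y + ∑∑ (f′ ∘commuteIndices))  ≈⟨ x∙yz≈y∙xz X Y _ ⟩
    Y + (X + ∑∑ (f′ ∘commuteIndices))  ≈⟨ ∑∑-split (f ∘commuteIndices) ⟨
    ∑∑ (f ∘commuteIndices)   ∎
    where
    X Y : A
    X = sum (f zero)
    Y = ∑[ i < suc n ] (f (suc i) zero)
    f′ : Fin (suc n) → Fin n → A
    f′ i j = f (suc i) (suc j)

  -- Pairs the terms off along commuteIndices (which has no fixed points), so it
  -- needs no division by 2.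
  ∑∑-antisymmetric : ∀ {n} (f : Fin (suc n) → Fin n → A) →
                     (∀ i j → (f ∘commuteIndices) i j ≈ - f i j) → ∑∑ f ≈ 0#
  ∑∑-antisymmetric {zero}  f anti = +-identityˡ 0#
  ∑∑-antisymmetric {suc n} f anti = begin
    ∑∑ f                                ≈⟨ ∑∑-split f ⟩
    X + (∑[ i < suc n ] (f (suc i) zero) + ∑∑ f′)
      ≈⟨ +-congˡ (+-cong (sum-cong-≋ (anti zero)) (∑∑-antisymmetric f′ (λ i j → anti (suc i) (suc j)))) ⟩
    X + (∑[ j < suc n ] (- f zero j) + 0#) ≈⟨ +-congˡ (trans (+-identityʳ _) (∑-neg (f zero))) ⟩
    X - X                               ≈⟨ -‿inverseʳ X ⟩
    0#                                  ∎
    where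
    X : A
    X = sum (f zero)
    f′ : Fin (suc n) → Fin n → A
    f′ i j = f (suc i) (suc j)

  ∑ₗ : ∀ {a} {X : Set a} → List X → (X → A) → A
  ∑ₗ []       f = 0#
  ∑ₗ (x ∷ xs) f = f x + ∑ₗ xs f

  ∑ₗ-cong-All : ∀ {a p} {X : Set a} {P : X → Set p} {xs : List X} {f g : X → A} →
                All P xs → (∀ {x} → P x → f x ≈ g x) → ∑ₗ xs f ≈ ∑ₗ xs g
  ∑ₗ-cong-All []         f≈g = refl
  ∑ₗ-cong-All (px ∷ pxs) f≈g = +-cong (f≈g px) (∑ₗ-cong-All pxs f≈g)

  ∑ₗ-cong : ∀ {a} {X : Set a} (xs : List X) {f g : X → A} → (∀ x → f x ≈ g x) → ∑ₗ xs f ≈ ∑ₗ xs g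
  ∑ₗ-cong xs f≈g = ∑ₗ-cong-All (All.universal {P = λ _ → ⊤} (λ _ → tt) xs) (λ {x} _ → f≈g x)

  ∑ₗ-+ : ∀ {a} {X : Set a} (xs : List X) (f g : X → A) → ∑ₗ xs (λ x → f x + g x) ≈ ∑ₗ xs f + ∑ₗ xs g
  ∑ₗ-+ []       f g = sym (+-identityˡ 0#)
  ∑ₗ-+ (x ∷ xs) f g = trans (+-congˡ (∑ₗ-+ xs f g)) (interchange _ _ _ _)

  ∑ₗ-neg : ∀ {a} {X : Set a} (xs : List X) (f : X → A) → ∑ₗ xs (λ x → - f x) ≈ - ∑ₗ xs f
  ∑ₗ-neg []       f = sym -0#≈0#
  ∑ₗ-neg (x ∷ xs) f = trans (+-congˡ (∑ₗ-neg xs f)) (-‿+-comm _ _)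

  ∑ₗ-sub : ∀ {a} {X : Set a} (xs : List X) (f g : X → A) → ∑ₗ xs (λ x → f x - g x) ≈ ∑ₗ xs f - ∑ₗ xs g
  ∑ₗ-sub xs f g = trans (∑ₗ-+ xs f (λ x → - g x)) (+-congˡ (∑ₗ-neg xs g))

  ∑ₗ-* : ∀ {a} {X : Set a} (xs : List X) (r : A) (f : X → A) → ∑ₗ xs (λ x → r * f x) ≈ r * ∑ₗ xs f
  ∑ₗ-* []       r f = sym (zeroʳ r)
  ∑ₗ-* (x ∷ xs) r f = trans (+-congˡ (∑ₗ-* xs r f)) (sym (distribˡ r _ _))

  ∑ₗ-++ : ∀ {a} {X : Set a} (xs ys : List X) (f : X → A) → ∑ₗ (xs ++ ys) f ≈ ∑ₗ xs f + ∑ₗ ys f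
  ∑ₗ-++ []       ys f = sym (+-identityˡ _)
  ∑ₗ-++ (x ∷ xs) ys f = trans (+-congˡ (∑ₗ-++ xs ys f)) (sym (+-assoc _ _ _))

  ∑ₗ-map : ∀ {a b} {X : Set a} {Y : Set b} (g : X → Y) (xs : List X) (f : Y → A) →
           ∑ₗ (map g xs) f ≡ ∑ₗ xs (f ∘ g)
  ∑ₗ-map g []       f = ≡.refl
  ∑ₗ-map g (x ∷ xs) f = ≡.cong (f (g x) +_) (∑ₗ-map g xs f)

  ∑ₗ-concatMap : ∀ {a b} {X : Set a} {Y : Set b} (F : X → List Y) (xs : List X) (f : Y → A) →
                 ∑ₗ (concatMap F xs) f ≈ ∑ₗ xs (λ x → ∑ₗ (F x) f)
  ∑ₗ-concatMap F []       f = refl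
  ∑ₗ-concatMap F (x ∷ xs) f = trans (∑ₗ-++ (F x) (concatMap F xs) f) (+-congˡ (∑ₗ-concatMap F xs f))

  ∑ₗ-tabulate : ∀ {a} {X : Set a} {n} (g : Fin n → X) (f : X → A) → ∑ₗ (tabulate g) f ≡ sum (f ∘ g)
  ∑ₗ-tabulate {n = zero}  g f = ≡.refl
  ∑ₗ-tabulate {n = suc n} g f = ≡.cong (f (g zero) +_) (∑ₗ-tabulate (g ∘ suc) f)

  ∑ₗ-allFin : ∀ {n} (f : Fin n → A) → ∑ₗ (allFin n) f ≡ sum f
  ∑ₗ-allFin = ∑ₗ-tabulate (λ i → i)

module ChainMap {c ℓ} (R : CommutativeRing c ℓ) (G : Graph) where

  open Chains R G
  open CommutativeRing R renaming (Carrier to A) hiding (zero)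
  open import Algebra.Properties.Ring ring using (-‿distribˡ-*; -‿distribʳ-*; -‿involutive; x[y-z]≈xy-xz)
  open import Relation.Binary.Reasoning.Setoid setoid
  open Sums R
  open Combinatorics
  open CubePaths

  -x*-y≈x*y : ∀ x y → - x * - y ≈ x * y
  -x*-y≈x*y x y = begin
    - x * - y       ≈⟨ -‿distribˡ-* x (- y) ⟨
    - (x * - y)     ≈⟨ -‿cong (-‿distribʳ-* x y) ⟨
    - (- (x * y))   ≈⟨ -‿involutive (x * y) ⟩
    x * y           ∎

  sgn-+ : ∀ a b → sgn (a +ℕ b) ≈ sgn a * sgn b
  sgn-+ zero    b = sym (*-identityˡ _)
  sgn-+ (suc a) b = trans (-‿cong (sgn-+ a b)) (-‿distribˡ-* _ _)

  sgn-commuteIndices : ∀ {n} (i : Fin (suc n)) (j : Fin n) → let (i′ , j′) = commuteIndices i j in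
                       sgn (toℕ i′) * sgn (toℕ j′) ≈ - (sgn (toℕ i) * sgn (toℕ j))
  sgn-commuteIndices {suc n} zero    j       = trans (*-identityʳ _) (-‿cong (sym (*-identityˡ _)))
  sgn-commuteIndices {suc n} (suc i) zero    =
    trans (*-identityˡ _) (trans (sym (-‿involutive _)) (-‿cong (sym (*-identityʳ _))))
  sgn-commuteIndices {suc n} (suc i) (suc j) =
    trans (-x*-y≈x*y _ _) (trans (sgn-commuteIndices i j) (-‿cong (sym (-x*-y≈x*y _ _))))

  Cochain : Set → ℕ → Set c
  Cochain X k = Vec X k → A

  δ : ∀ {X k} → Cochain X k → Cochain X (suc k)
  δ {k = k} h t = ∑[ j < suc k ] (sgn (toℕ j) * h (removeAt t j))

  pullback : ∀ {X Y : Set} {k} → (X → Y) → Cochain Y k → Cochain X k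
  pullback f h v = h (Vec.map f v)

  atOrigin : ∀ {n k} → Cochain (Cube n) (suc k) → Cochain (Cube n) k
  atOrigin {n} h v = h (replicate n false ∷ v)

  coface : ∀ {n} → Bool → Fin (suc n) → Cube n → Cube (suc n)
  coface ε i y = insertAt y i ε

  ψ* : ∀ {n} → Cochain (Cube n) (suc n) → A
  ψ* {n} h = ∑ₗ (perms n) (λ τ → sgn (inversions τ) * h (pτ τ))

  faceSum : ∀ {n} → Bool → Cochain (Cube (suc n)) (suc n) → A
  faceSum {n} ε h = ∑[ i < suc n ] (sgn (toℕ i) * ψ* (pullback (coface ε i) h))

  ψ*-cong : ∀ {n} {h h′ : Cochain (Cube n) (suc n)} → (∀ v → h v ≈ h′ v) → ψ* h ≈ ψ* h′
  ψ*-cong {n} h≈h′ = ∑ₗ-cong (perms n) (λ τ → *-congˡ (h≈h′ (pτ τ)))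

  ψ*-sub : ∀ {n} (h h′ : Cochain (Cube n) (suc n)) → ψ* (λ v → h v - h′ v) ≈ ψ* h - ψ* h′
  ψ*-sub {n} h h′ = trans (∑ₗ-cong (perms n) (λ τ → x[y-z]≈xy-xz _ _ _)) (∑ₗ-sub (perms n) _ _)

  -- Sort permutations by their first value i: the first step of the path
  -- leaves the origin, and the rest runs in the face xᵢ = 1.
  ψ*-atOrigin : ∀ {n} (h : Cochain (Cube (suc n)) (suc (suc n))) → ψ* h ≈ faceSum true (atOrigin h)
  ψ*-atOrigin {n} h = begin
    ψ* h
      ≈⟨ ∑ₗ-concatMap cons (allFin (suc n)) term ⟩
    ∑ₗ (allFin (suc n)) (λ i → ∑ₗ (cons i) term)
      ≡⟨ ∑ₗ-allFin (λ i → ∑ₗ (cons i) term) ⟩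
    ∑[ i < suc n ] ∑ₗ (cons i) term
      ≈⟨ sum-cong-≋ (λ i → trans (reflexive (∑ₗ-map (i ∷ᵖ_) (perms n) term)) (termsWithFirst i)) ⟩
    faceSum true (atOrigin h) ∎
    where
    _∷ᵖ_ : Fin (suc n) → Vec (Fin n) n → Vec (Fin (suc n)) (suc n)
    i ∷ᵖ p = i ∷ Vec.map (punchIn i) p
    cons : Fin (suc n) → List (Vec (Fin (suc n)) (suc n))
    cons i = map (i ∷ᵖ_) (perms n)
    term : Vec (Fin (suc n)) (suc n) → A
    term τ = sgn (inversions τ) * h (pτ τ)
    termsWithFirst : ∀ i → ∑ₗ (perms n) (term ∘ (i ∷ᵖ_))
                           ≈ sgn (toℕ i) * ψ* (pullback (coface true i) (atOrigin h))
    termsWithFirst i = trans (∑ₗ-cong-All (perms-isPermutation n) term-∷) (∑ₗ-* (perms n) _ _)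
      where
      term-∷ : ∀ {p} → IsPermutation p →
               term (i ∷ᵖ p) ≈ sgn (toℕ i) * (sgn (inversions p) * pullback (coface true i) (atOrigin h) (pτ p))
      term-∷ {p} perm = begin
        sgn (inversions (i ∷ᵖ p)) * h (pτ (i ∷ᵖ p))
          ≈⟨ *-cong (trans (reflexive (≡.cong sgn (inversions-perms-∷ i p perm))) (sgn-+ (toℕ i) (inversions p)))
                    (reflexive (≡.cong h (pτ-∷ i p))) ⟩
        (sgn (toℕ i) * sgn (inversions p)) * pullback (coface true i) (atOrigin h) (pτ p)
          ≈⟨ *-assoc _ _ _ ⟩
        sgn (toℕ i) * (sgn (inversions p) * pullback (coface true i) (atOrigin h) (pτ p)) ∎

  δ-pullback : ∀ {X Y : Set} {k} (f : X → Y) (h : Cochain Y k) (v : Vec X (suc k)) →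
               δ (pullback f h) v ≡ pullback f (δ h) v
  δ-pullback f h v = sum-cong-≗ (λ j → ≡.cong (λ t → sgn (toℕ j) * h t) (≡.sym (removeAt-map f v j)))

  atOrigin-δ : ∀ {n k} (h : Cochain (Cube n) (suc k)) (v : Vec (Cube n) (suc k)) →
               atOrigin (δ h) v ≈ h v - δ (atOrigin h) v
  atOrigin-δ h (y ∷ v) = +-cong (*-identityˡ _)
    (trans (sum-cong-≋ (λ j → sym (-‿distribˡ-* (sgn (toℕ j)) (atOrigin h (removeAt (y ∷ v) j)))))
           (∑-neg (λ j → sgn (toℕ j) * atOrigin h (removeAt (y ∷ v) j))))

  atOrigin-coface-false : ∀ {n k} (i : Fin (suc n)) (h : Cochain (Cube (suc n)) (suc k)) (v : Vec (Cube n) k) →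
                          atOrigin (pullback (coface false i) h) v ≡ pullback (coface false i) (atOrigin h) v
  atOrigin-coface-false i h v = ≡.cong (λ o → h (o ∷ Vec.map (coface false i) v)) (insertAt-replicate false i)

  pullback-cofaces : ∀ {n k} (ε ε′ : Bool) (i : Fin (suc (suc n))) (j : Fin (suc n))
                     (h : Cochain (Cube (suc (suc n))) k) (v : Vec (Cube n) k) →
                     let (i′ , j′) = commuteIndices i j in
                     pullback (coface ε j) (pullback (coface ε′ i) h) v
                       ≡ pullback (coface ε′ j′) (pullback (coface ε i′) h) v
  pullback-cofaces ε ε′ i j h v = ≡.cong h
    (≡.trans (≡.sym (map-∘ (coface ε′ i) (coface ε j) v))
    (≡.trans (map-cong (λ y → insertAt-insertAt y i j ε′ ε) v)
             (map-∘ (coface ε (proj₁ (commuteIndices i j))) (coface ε′ (proj₂ (commuteIndices i j))) v)))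

  faceSum-cong : ∀ {n} ε {h h′ : Cochain (Cube (suc n)) (suc n)} →
                 (∀ v → h v ≈ h′ v) → faceSum ε h ≈ faceSum ε h′
  faceSum-cong ε h≈h′ =
    sum-cong-≋ (λ i → *-congˡ {sgn (toℕ i)} (ψ*-cong (λ v → h≈h′ (Vec.map (coface ε i) v))))

  faceTerm² : ∀ {n} → Bool → Bool → Cochain (Cube (suc (suc n))) (suc n) → Fin (suc (suc n)) → Fin (suc n) → A
  faceTerm² ε ε′ h i j = sgn (toℕ i) * (sgn (toℕ j) * ψ* (pullback (coface ε′ j) (pullback (coface ε i) h)))

  faceSum-faceSum : ∀ {n} ε ε′ (h : Cochain (Cube (suc (suc n))) (suc n)) →
                    ∑[ i < suc (suc n) ] (sgn (toℕ i) * faceSum ε′ (pullback (coface ε i) h))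
                      ≈ ∑∑ (faceTerm² ε ε′ h)
  faceSum-faceSum ε ε′ h = sum-cong-≋ (λ i → *-distribˡ-sum (sgn (toℕ i))
    (λ j → sgn (toℕ j) * ψ* (pullback (coface ε′ j) (pullback (coface ε i) h))))

  faceTerm²-commuteIndices : ∀ {n} ε ε′ (h : Cochain (Cube (suc (suc n))) (suc n)) i j →
                             (faceTerm² ε ε′ h ∘commuteIndices) i j ≈ - faceTerm² ε′ ε h i j
  faceTerm²-commuteIndices ε ε′ h i j = begin
    sgn (toℕ i′) * (sgn (toℕ j′) * X′)   ≈⟨ *-assoc _ _ _ ⟨
    (sgn (toℕ i′) * sgn (toℕ j′)) * X′   ≈⟨ *-cong (sgn-commuteIndices i j)
                                                    (ψ*-cong (λ v → reflexive (≡.sym (pullback-cofaces ε ε′ i j h v)))) ⟩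
    - (sgn (toℕ i) * sgn (toℕ j)) * X    ≈⟨ -‿distribˡ-* _ _ ⟨
    - ((sgn (toℕ i) * sgn (toℕ j)) * X)  ≈⟨ -‿cong (*-assoc _ _ _) ⟩
    - faceTerm² ε′ ε h i j               ∎
    where
    i′ : Fin (suc (suc _))
    i′ = proj₁ (commuteIndices i j)
    j′ : Fin (suc _)
    j′ = proj₂ (commuteIndices i j)
    X′ X : A
    X′ = ψ* (pullback (coface ε′ j′) (pullback (coface ε i′) h))
    X  = ψ* (pullback (coface ε j) (pullback (coface ε′ i) h))

  ∑∑-faceTerm²-swap : ∀ {n} ε ε′ (h : Cochain (Cube (suc (suc n))) (suc n)) →
                      ∑∑ (faceTerm² ε ε′ h) ≈ - ∑∑ (faceTerm² ε′ ε h)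
  ∑∑-faceTerm²-swap ε ε′ h = begin
    ∑∑ (faceTerm² ε ε′ h)                   ≈⟨ ∑∑-commuteIndices (faceTerm² ε ε′ h) ⟩
    ∑∑ (faceTerm² ε ε′ h ∘commuteIndices)
      ≈⟨ sum-cong-≋ (λ i → sum-cong-≋ (faceTerm²-commuteIndices ε ε′ h i)) ⟩
    ∑∑ (λ i j → - faceTerm² ε′ ε h i j)     ≈⟨ ∑∑-neg (faceTerm² ε′ ε h) ⟩
    - ∑∑ (faceTerm² ε′ ε h)                 ∎

  ∑∑-faceTerm²-diagonal : ∀ {n} ε (h : Cochain (Cube (suc (suc n))) (suc n)) → ∑∑ (faceTerm² ε ε h) ≈ 0#
  ∑∑-faceTerm²-diagonal ε h = ∑∑-antisymmetric (faceTerm² ε ε h) (faceTerm²-commuteIndices ε ε h)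

  BoundaryFormula : ℕ → Set (c ⊔ ℓ)
  BoundaryFormula n = ∀ (h : Cochain (Cube (suc n)) (suc n)) → ψ* (δ h) ≈ faceSum true h - faceSum false h

  -- Deleting a vertex other than the origin contributes the faces xᵢ = 0.
  TailFormula : ℕ → Set (c ⊔ ℓ)
  TailFormula n = ∀ (h : Cochain (Cube (suc n)) (suc n)) →
    ∑[ i < suc n ] (sgn (toℕ i) * ψ* (δ (pullback (coface true i) (atOrigin h)))) ≈ faceSum false h

  boundaryFormula : ∀ {n} → TailFormula n → BoundaryFormula n
  boundaryFormula {n} tail h = begin
    ψ* (δ h)
      ≈⟨ ψ*-atOrigin (δ h) ⟩
    faceSum true (atOrigin (δ h))
      ≈⟨ sum-cong-≋ (λ i → *-congˡ {sgn (toℕ i)} (ψ*-cong (deleteOrigin i))) ⟩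
    ∑[ i < suc n ] (sgn (toℕ i) * ψ* (λ v → Fh i v - δ (Fk i) v))
      ≈⟨ sum-cong-≋ (λ i → *-congˡ {sgn (toℕ i)} (ψ*-sub (Fh i) (δ (Fk i)))) ⟩
    ∑[ i < suc n ] (sgn (toℕ i) * (ψ* (Fh i) - ψ* (δ (Fk i))))
      ≈⟨ ∑-*-sub (λ i → sgn (toℕ i)) (λ i → ψ* (Fh i)) (λ i → ψ* (δ (Fk i))) ⟩
    faceSum true h - ∑[ i < suc n ] (sgn (toℕ i) * ψ* (δ (Fk i)))
      ≈⟨ +-congˡ (-‿cong (tail h)) ⟩
    faceSum true h - faceSum false h ∎
    where
    Fh : Fin (suc n) → Cochain (Cube n) (suc n)
    Fh i = pullback (coface true i) h
    Fk : Fin (suc n) → Cochain (Cube n) n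
    Fk i = pullback (coface true i) (atOrigin h)
    deleteOrigin : ∀ i v → pullback (coface true i) (atOrigin (δ h)) v ≈ Fh i v - δ (Fk i) v
    deleteOrigin i v = trans (atOrigin-δ h (Vec.map (coface true i) v))
                             (+-congˡ (-‿cong (reflexive (≡.sym (δ-pullback (coface true i) (atOrigin h) v)))))

  -- In dimension 1 both sides evaluate h on the one-step path from the origin.
  tailFormula-zero : TailFormula zero
  tailFormula-zero h = trans (1*x+0≈x _) (trans (1*x+0≈x _) (trans (1*x+0≈x _) (sym (trans (1*x+0≈x _) (1*x+0≈x _)))))
    where
    1*x+0≈x : ∀ x → 1# * x + 0# ≈ x
    1*x+0≈x x = trans (+-identityʳ _) (*-identityˡ x)

  tailFormula-suc : ∀ {n} → BoundaryFormula n → TailFormula (suc n)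
  tailFormula-suc {n} boundary h = begin
    ∑[ i < suc (suc n) ] (sgn (toℕ i) * ψ* (δ (F true i k)))
      ≈⟨ sum-cong-≋ (λ i → *-congˡ {sgn (toℕ i)} (boundary (F true i k))) ⟩
    ∑[ i < suc (suc n) ] (sgn (toℕ i) * (faceSum true (F true i k) - faceSum false (F true i k)))
      ≈⟨ ∑-*-sub (λ i → sgn (toℕ i)) (λ i → faceSum true (F true i k)) (λ i → faceSum false (F true i k)) ⟩
    ∑[ i < suc (suc n) ] (sgn (toℕ i) * faceSum true (F true i k))
      - ∑[ i < suc (suc n) ] (sgn (toℕ i) * faceSum false (F true i k))
      ≈⟨ +-cong (faceSum-faceSum true true k) (-‿cong (faceSum-faceSum true false k)) ⟩
    ∑∑ (faceTerm² true true k) - ∑∑ (faceTerm² true false k)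
      ≈⟨ +-cong (∑∑-faceTerm²-diagonal true k) (-‿cong (∑∑-faceTerm²-swap true false k)) ⟩
    0# - - ∑∑ (faceTerm² false true k)
      ≈⟨ trans (+-identityˡ _) (-‿involutive _) ⟩
    ∑∑ (faceTerm² false true k)
      ≈⟨ faceSum-faceSum false true k ⟨
    ∑[ i < suc (suc n) ] (sgn (toℕ i) * faceSum true (F false i k))
      ≈⟨ sum-cong-≋ (λ i → *-congˡ {sgn (toℕ i)}
           (faceSum-cong true (λ v → reflexive (atOrigin-coface-false i h v)))) ⟨
    ∑[ i < suc (suc n) ] (sgn (toℕ i) * faceSum true (atOrigin (F false i h)))
      ≈⟨ sum-cong-≋ (λ i → *-congˡ {sgn (toℕ i)} (ψ*-atOrigin (F false i h))) ⟨
    faceSum false h ∎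
    where
    k : Cochain (Cube (suc (suc n))) (suc n)
    k = atOrigin h
    F : ∀ {l} → Bool → Fin (suc (suc n)) → Cochain (Cube (suc (suc n))) l → Cochain (Cube (suc n)) l
    F ε i = pullback (coface ε i)

  tailFormula : ∀ n → TailFormula n
  tailFormula zero    = tailFormula-zero
  tailFormula (suc n) = tailFormula-suc (boundaryFormula (tailFormula n))

  ψ*-δ : ∀ n → BoundaryFormula n
  ψ*-δ n = boundaryFormula (tailFormula n)

  ⟨_∣_⟩ : ∀ {X : Set} {k} → Cochain X k → List (A × Vec X k) → A
  ⟨ g ∣ x ⟩ = ∑ₗ x (λ (r , t) → r * g t)

  indicator : ∀ {m} → Tuple m → Cochain (Fin (size G)) m
  indicator t u = if does (≡-dec _≟ᶠ_ u t) then 1# else 0#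

  coeff-as-pairing : ∀ {m} (x : Chain m) (t : Tuple m) → coeff x t ≈ ⟨ indicator t ∣ x ⟩
  coeff-as-pairing []             t = refl
  coeff-as-pairing ((r , u) ∷ xs) t with ≡-dec _≟ᶠ_ u t
  ... | yes _ = +-cong (sym (*-identityʳ r)) (coeff-as-pairing xs t)
  ... | no  _ = trans (sym (+-identityˡ _)) (+-cong (sym (zeroʳ r)) (coeff-as-pairing xs t))

  ≈ᶜ-from-pairings : ∀ {m} (x y : Chain (suc m)) → (∀ g → ⟨ g ∣ x ⟩ ≈ ⟨ g ∣ y ⟩) → x ≈ᶜ y
  ≈ᶜ-from-pairings x y x≈y t _ =
    trans (coeff-as-pairing x t) (trans (x≈y (indicator t)) (sym (coeff-as-pairing y t)))

  pairing-∂Path : ∀ {m} (g : Cochain (Fin (size G)) (suc m)) (x : Chain (suc (suc m))) →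
                  ⟨ g ∣ ∂Path x ⟩ ≈ ⟨ δ g ∣ x ⟩
  pairing-∂Path {m} g []            = refl
  pairing-∂Path {m} g ((r , t) ∷ x) = begin
    ⟨ g ∣ faces ++ ∂Path x ⟩                                   ≈⟨ ∑ₗ-++ faces (∂Path x) _ ⟩
    ⟨ g ∣ faces ⟩ + ⟨ g ∣ ∂Path x ⟩                            ≈⟨ +-cong faces-pairing (pairing-∂Path g x) ⟩
    r * δ g t + ⟨ δ g ∣ x ⟩                                     ∎
    where
    faces : Chain (suc m)
    faces = map (λ i → (r * sgn (toℕ i) , removeAt t i)) (allFin (suc (suc m)))
    faces-pairing : ⟨ g ∣ faces ⟩ ≈ r * δ g t
    faces-pairing = begin
      ⟨ g ∣ faces ⟩
        ≡⟨ ≡.trans (∑ₗ-map _ (allFin (suc (suc m))) _)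
                   (∑ₗ-allFin (λ i → (r * sgn (toℕ i)) * g (removeAt t i))) ⟩
      ∑[ i < suc (suc m) ] ((r * sgn (toℕ i)) * g (removeAt t i))
        ≈⟨ sum-cong-≋ (λ i → *-assoc r (sgn (toℕ i)) (g (removeAt t i))) ⟩
      ∑[ i < suc (suc m) ] (r * (sgn (toℕ i) * g (removeAt t i)))
        ≈⟨ *-distribˡ-sum r (λ i → sgn (toℕ i) * g (removeAt t i)) ⟨
      r * δ g t ∎

  pairing-ψmap : ∀ {n} (g : Cochain (Fin (size G)) (suc n)) (f : Cube n → Fin (size G)) →
                 ⟨ g ∣ ψmap f ⟩ ≡ ψ* (pullback f g)
  pairing-ψmap {n} g f = ∑ₗ-map _ (perms n) _

  pairing-scale : ∀ {m} (g : Cochain (Fin (size G)) m) (r : A) (x : Chain m) → ⟨ g ∣ scale r x ⟩ ≈ r * ⟨ g ∣ x ⟩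
  pairing-scale g r x =
    trans (reflexive (∑ₗ-map _ x _)) (trans (∑ₗ-cong x (λ _ → *-assoc _ _ _)) (∑ₗ-* x r _))

  pairing-ψlin : ∀ {n} (g : Cochain (Fin (size G)) (suc n)) (xs : CubeChain n) →
                 ⟨ g ∣ ψlin xs ⟩ ≈ ∑ₗ xs (λ (r , f) → r * ψ* (pullback f g))
  pairing-ψlin g xs = trans (∑ₗ-concatMap _ xs _) (∑ₗ-cong xs λ (r , f) →
    trans (pairing-scale g r (ψmap f)) (*-congˡ (reflexive (pairing-ψmap g f))))

  cubeFaces : ∀ {n} → SingularCube G (suc n) → Fin (suc n) → CubeChain n
  cubeFaces σ i = (sgn (suc (toℕ i)) , face false i (fun σ)) ∷ (- sgn (suc (toℕ i)) , face true i (fun σ)) ∷ []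

  pairing-ψlin-∂Cube : ∀ {m} (g : Cochain (Fin (size G)) (suc m)) (σ : SingularCube G (suc m)) →
                       ⟨ g ∣ ψlin (∂Cube σ) ⟩
                         ≈ faceSum true (pullback (fun σ) g) - faceSum false (pullback (fun σ) g)
  pairing-ψlin-∂Cube {m} g σ = begin
    ⟨ g ∣ ψlin (∂Cube σ) ⟩
      ≈⟨ pairing-ψlin g (∂Cube σ) ⟩
    ∑ₗ (∂Cube σ) term
      ≈⟨ ∑ₗ-concatMap (cubeFaces σ) (allFin (suc m)) term ⟩
    ∑ₗ (allFin (suc m)) (λ i → ∑ₗ (cubeFaces σ i) term)
      ≡⟨ ∑ₗ-allFin (λ i → ∑ₗ (cubeFaces σ i) term) ⟩
    ∑[ i < suc m ] ∑ₗ (cubeFaces σ i) term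
      ≈⟨ sum-cong-≋ (λ i → facePair (sgn (toℕ i)) (ψ*-face false i) (ψ*-face true i)) ⟩
    ∑[ i < suc m ] (sgn (toℕ i) * (ψ* (F true i) - ψ* (F false i)))
      ≈⟨ ∑-*-sub (λ i → sgn (toℕ i)) (λ i → ψ* (F true i)) (λ i → ψ* (F false i)) ⟩
    faceSum true h - faceSum false h ∎
    where
    h : Cochain (Cube (suc m)) (suc m)
    h = pullback (fun σ) g
    term : A × (Cube m → Fin (size G)) → A
    term (r , f) = r * ψ* (pullback f g)
    F : Bool → Fin (suc m) → Cochain (Cube m) (suc m)
    F ε i = pullback (coface ε i) h
    ψ*-face : ∀ ε i → ψ* (pullback (face ε i (fun σ)) g) ≈ ψ* (F ε i)
    ψ*-face ε i = ψ*-cong (λ v → reflexive (≡.cong g (map-∘ (fun σ) (coface ε i) v)))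
    -- The two terms of cubeFaces σ i, where sgn (suc i) unfolds to - sgn i.
    facePair : ∀ s {X X′ Y Y′} → X ≈ X′ → Y ≈ Y′ → - s * X + (- - s * Y + 0#) ≈ s * (Y′ - X′)
    facePair s {X} {X′} {Y} {Y′} X≈X′ Y≈Y′ = begin
      - s * X + (- - s * Y + 0#)
        ≈⟨ +-cong (-‿distribˡ-* s X) (sym (trans (+-identityʳ _) (*-congʳ (-‿involutive s)))) ⟨
      - (s * X) + s * Y           ≈⟨ +-comm _ _ ⟩
      s * Y - s * X               ≈⟨ x[y-z]≈xy-xz s Y X ⟨
      s * (Y - X)                 ≈⟨ *-congˡ (+-cong Y≈Y′ (-‿cong X≈X′)) ⟩
      s * (Y′ - X′)               ∎

  ∂Path-ψ : ∀ {m} (σ : SingularCube G (suc m)) → ∂Path (ψ σ) ≈ᶜ ψlin (∂Cube σ)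
  ∂Path-ψ {m} σ = ≈ᶜ-from-pairings (∂Path (ψ σ)) (ψlin (∂Cube σ)) λ g → begin
    ⟨ g ∣ ∂Path (ψ σ) ⟩             ≈⟨ pairing-∂Path g (ψ σ) ⟩
    ⟨ δ g ∣ ψ σ ⟩                   ≡⟨ pairing-ψmap (δ g) (fun σ) ⟩
    ψ* (pullback (fun σ) (δ g))     ≈⟨ ψ*-cong (λ v → reflexive (≡.sym (δ-pullback (fun σ) g v))) ⟩
    ψ* (δ (pullback (fun σ) g))     ≈⟨ ψ*-δ m (pullback (fun σ) g) ⟩
    faceSum true (pullback (fun σ) g) - faceSum false (pullback (fun σ) g) ≈⟨ pairing-ψlin-∂Cube g σ ⟨
    ⟨ g ∣ ψlin (∂Cube σ) ⟩          ∎

  Adj⁼ : Fin (size G) → Fin (size G) → Set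
  Adj⁼ u v = u ≡ v ⊎ Adj G u v

  LazyWalk : ∀ {m} → Tuple (suc m) → Set
  LazyWalk {zero}  (u ∷ [])    = ⊤
  LazyWalk {suc m} (u ∷ v ∷ t) = Adj⁼ u v × LazyWalk (v ∷ t)

  lazyWalk-allowed⊎degenerate : ∀ {m} (t : Tuple (suc m)) → LazyWalk t → Allowed t ⊎ Degenerate t
  lazyWalk-allowed⊎degenerate {zero}  (u ∷ [])    _              = inj₁ (λ ())
  lazyWalk-allowed⊎degenerate {suc m} (u ∷ v ∷ t) (inj₁ u≡v , _) = inj₂ (zero , u≡v)
  lazyWalk-allowed⊎degenerate {suc m} (u ∷ v ∷ t) (inj₂ u~v , w) with lazyWalk-allowed⊎degenerate (v ∷ t) w
  ... | inj₁ allowed      = inj₁ (λ { zero → u~v ; (suc i) → allowed i })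
  ... | inj₂ (i , vᵢ≡vᵢ₊₁) = inj₂ (suc i , vᵢ≡vᵢ₊₁)

  forget : ∀ {m} → List (A × Σ (Tuple (suc m)) Allowed) → Chain (suc m)
  forget = map (λ (r , (t , _)) → (r , t))

  inTilde-lazyWalks : ∀ {m} (x : Chain (suc m)) → All (LazyWalk ∘ proj₂) x → InTilde x
  inTilde-lazyWalks []             []       = [] , λ _ _ → refl
  inTilde-lazyWalks ((r , u) ∷ xs) (w ∷ ws) with inTilde-lazyWalks xs ws | lazyWalk-allowed⊎degenerate u w
  ... | ys , xs≈ys | inj₁ allowed = ((r , (u , allowed)) ∷ ys) , keep
    where
    keep : ((r , u) ∷ xs) ≈ᶜ forget ((r , (u , allowed)) ∷ ys)
    keep t nd with ≡-dec _≟ᶠ_ u t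
    ... | yes _ = +-congˡ (xs≈ys t nd)
    ... | no  _ = xs≈ys t nd
  ... | ys , xs≈ys | inj₂ degenerate = ys , drop
    where
    drop : ((r , u) ∷ xs) ≈ᶜ forget ys
    drop t nd with ≡-dec _≟ᶠ_ u t
    ... | yes u≡t = ⊥-elim (nd (≡.subst Degenerate u≡t degenerate))
    ... | no  _   = xs≈ys t nd

  inTilde-resp-≈ᶜ : ∀ {m} {x y : Chain (suc m)} → x ≈ᶜ y → InTilde y → InTilde x
  inTilde-resp-≈ᶜ x≈y (ys , y≈ys) = ys , λ t nd → trans (x≈y t nd) (y≈ys t nd)

  IsHom : ∀ {n} → (Cube n → Fin (size G)) → Set
  IsHom f = ∀ x i → Adj⁼ (f x) (f (flip x i))

  isHom-face : ∀ {n} {f : Cube (suc n) → Fin (size G)} ε i → IsHom f → IsHom (face ε i f)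
  isHom-face {f = f} ε i hom a c = ≡.subst (λ y → Adj⁼ (f (insertAt a i ε)) (f y))
    (updateAt-insertAt a i ε c not) (hom (insertAt a i ε) (punchIn i c))

  isHom-[]≔true : ∀ {n} {f : Cube n → Fin (size G)} → IsHom f → ∀ y c → Adj⁼ (f y) (f (y [ c ]≔ true))
  isHom-[]≔true {f = f} hom y c with []≔true-or-flip y c
  ... | inj₁ e = inj₁ (≡.cong f (≡.sym e))
  ... | inj₂ e = ≡.subst (λ z → Adj⁼ (f y) (f z)) (≡.sym e) (hom y c)

  lazyWalk-cubePath : ∀ {n m} {f : Cube n → Fin (size G)} → IsHom f →
                      ∀ (cs : Vec (Fin n) m) x → LazyWalk (Vec.map f (cubePath cs x))
  lazyWalk-cubePath hom []            x = tt
  lazyWalk-cubePath hom (c ∷ [])      x = isHom-[]≔true hom x c , tt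
  lazyWalk-cubePath hom (c ∷ c′ ∷ cs) x = isHom-[]≔true hom x c , lazyWalk-cubePath hom (c′ ∷ cs) (x [ c ]≔ true)

  ψmap-lazyWalks : ∀ {n} {f : Cube n → Fin (size G)} → IsHom f → All (LazyWalk ∘ proj₂) (ψmap f)
  ψmap-lazyWalks {n} hom = map⁺ (All.universal (λ τ → lazyWalk-cubePath hom τ (replicate n false)) (perms n))

  ψlin-lazyWalks : ∀ {n} (xs : CubeChain n) → All (IsHom ∘ proj₂) xs → All (LazyWalk ∘ proj₂) (ψlin xs)
  ψlin-lazyWalks []             []           = []
  ψlin-lazyWalks ((r , f) ∷ xs) (hom ∷ homs) = ++⁺ (map⁺ (ψmap-lazyWalks hom)) (ψlin-lazyWalks xs homs)

  ∂Cube-homs : ∀ {n} (σ : SingularCube G (suc n)) → All (IsHom ∘ proj₂) (∂Cube σ)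
  ∂Cube-homs σ = concat⁺ (map⁺ {f = cubeFaces σ} (tabulate⁺ {f = λ i → i} λ i →
    isHom-face false i (hom σ) ∷ isHom-face true i (hom σ) ∷ []))

  ψ-inTilde : ∀ {m} (σ : SingularCube G (suc m)) → InTilde (ψ σ)
  ψ-inTilde σ = inTilde-lazyWalks (ψ σ) (ψmap-lazyWalks (hom σ))

  ∂Path-ψ-inTilde : ∀ {m} (σ : SingularCube G (suc m)) → InTilde (∂Path (ψ σ))
  ∂Path-ψ-inTilde σ = inTilde-resp-≈ᶜ {x = ∂Path (ψ σ)} {ψlin (∂Cube σ)} (∂Path-ψ σ)
    (inTilde-lazyWalks (ψlin (∂Cube σ)) (ψlin-lazyWalks (∂Cube σ) (∂Cube-homs σ)))

lemma5p1 : ∀ {c ℓ : Level} (R : CommutativeRing c ℓ) (G : Graph) (m : ℕ)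
    (σ : SingularCube G (suc m)) →
    let open Chains R G in
    InTilde (∂Path (ψ σ))
    × InPathComplex (ψ σ)
    × (∂Path (ψ σ) ≈ᶜ ψlin (∂Cube σ))
lemma5p1 R G m σ = ∂Path-ψ-inTilde σ , (ψ-inTilde σ , ∂Path-ψ-inTilde σ) , ∂Path-ψ σ
  where open ChainMap R G
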